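{- Let $N$ be a finite partly cancellative nilsemigroup with identity, nil $\infty$, and atoms $p_1,\dots,p_k$. Consider the graph with vertex set \[ Z=\{z\in\mathsf Z_N(\infty): z-e_i\notin\mathsf Z_N(\infty)\text{ for each } i\in\operatorname{supp}(z)\}, \] in which two vertices $z,z'\in Z$ are joined by an edge whenever there exist $i\in\operatorname{supp}(z)\cap\operatorname{supp}(z')$ and $p\in N\setminus\{\infty\}$ with $z-e_i,\,z'-e_i\in\mathsf Z_N(p)$. Then: (a) each outer Betti element $B$ of $N$ is (the vertex set of) a connected component of this graph, and the restriction of the graph to $B$ is the graph $\nabla_B$; (b) if $N$ is a Kunz nilsemigroup, then for each connected component $B$ of this graph, $\overline z=\overline{z'}$ for all $z,z'\in B$.
   Context: Semigroup terminology: in a commutative semigroup $(N,+)$, a nil is an element $\infty$ with $a+\infty=\infty$ for all $a$; $a$ is nilpotent if $na=\infty$ for some $n\ge1$; $a$ is partly cancellative if $a+b=a+c\ne\infty$ implies $b=c$. A nilsemigroup with identity has an identity $0$ and every non-identity element nilpotent; it is partly cancellative if every non-nil element is partly cancellative. Atoms of $N$ are the elements other than $0$ and $\infty$ that cannot be written as a sum of two elements different from $0$. For $u\in N$, $\mathsf Z_N(u)=\{z\in\mathbb Z_{\ge0}^k: z_1p_1+\cdots+z_kp_k=u\}$; $e_i$ is the $i$-th standard basis vector; $\operatorname{supp}(z)=\{i: z_i>0\}$; for a set $Z'$ of tuples, $\operatorname{supp}(Z')=\bigcup_{z\in Z'}\operatorname{supp}(z)$ and, for $i\in\operatorname{supp}(Z')$,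 $Z'-e_i=\{z-e_i: z\in Z',\, i\in\operatorname{supp}(z)\}$. For a set $Z'$ of tuples, $\nabla_{Z'}$ is the graph with vertex set $Z'$ where $z,z'$ are adjacent iff $\operatorname{supp}(z)\cap\operatorname{supp}(z')\ne\emptyset$. An outer Betti element of $N$ is a set $B\subseteq\mathsf Z_N(\infty)$ such that (i) for each $i\in\operatorname{supp}(B)$, $B-e_i=\mathsf Z_N(p)$ for some $p\in N\setminus\{\infty\}$, and (ii) $\nabla_B$ is connected. Kunz nilsemigroup: given a finite abelian group $G$ and a face $F$ of the group cone $\mathcal C(G)=\{x\in\mathbb R^{G\setminus\{0\}}: x_i+x_j\ge x_{i+j}\ \forall i,j\ne0,\ i+j\ne0\}$ (convention $x_0=0$; a face is a nonempty subset cut out by turning some of these inequalities into equalities), with Kunz subgroup $H=\{h: x_h=0\ \forall x\in F\}$, the Kunz nilsemigroup is $N=(G/H)\cup\{\infty\}$ with $\infty$ absorbing and $\overline a\oplus\overline b=\overline a+\overline b$ if $x_a+x_b=x_{a+b}$ for all $x\in F$, and $\infty$ otherwise; it is a finite partly cancellative nilsemigroup with identity. For such $N$, $N\setminus\{\infty\}=G/H$ is a group and $\overline z=z_1p_1+\cdots+z_kp_k$ computed in the group $G/H$.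
   Formalization: The group cone and its faces, from which the Kunz subgroup and the Kunz operation are defined, consist of points with rational coordinates rather than points of $\mathbb R^{G\setminus\{0\}}$. -}

module Defs where

open import Level using (0ℓ)
open import Data.Nat using (ℕ; zero; suc; _<_; _≤_; _∸_)
open import Data.Fin using (Fin)
import Data.Fin as Fin
open import Data.Vec using (Vec; []; _∷_; lookup; updateAt)
open import Data.Product using (Σ; ∃; _×_; _,_)
open import Data.Sum using (_⊎_)
open import Relation.Nullary using (¬_)
open import Relation.Binary.PropositionalEquality using (_≡_; _≢_)
open import Relation.Binary.Construct.Closure.ReflexiveTransitive using (Star)
open import Algebra.Structures using (IsCommutativeMonoid)
open import Algebra.Bundles using (AbelianGroup)
open import Function.Bundles using (_⇔_)
import Data.Rational as ℚ
open ℚ using (ℚ)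

times : {A : Set} → (A → A → A) → A → ℕ → A → A
times _⊕_ e zero    a = e
times _⊕_ e (suc n) a = a ⊕ times _⊕_ e n a

record PCNilsemigroup : Set₁ where
  infixl 6 _⊕_
  field
    Carrier   : Set
    _⊕_       : Carrier → Carrier → Carrier
    𝟎         : Carrier
    ∞         : Carrier
    isCommutativeMonoid : IsCommutativeMonoid _≡_ _⊕_ 𝟎
    nil       : ∀ a → a ⊕ ∞ ≡ ∞
  field
    nilpotent : ∀ a → a ≢ 𝟎 → Σ ℕ λ n → (1 ≤ n) × (times _⊕_ 𝟎 n a ≡ ∞)
    partlyCancellative : ∀ a b c → a ≢ ∞ → a ⊕ b ≡ a ⊕ c → a ⊕ b ≢ ∞ → b ≡ c
    finite    : Σ ℕ λ m → Σ (Fin m → Carrier) λ f → ∀ a → ∃ λ i → f i ≡ a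

  IsAtom : Carrier → Set
  IsAtom a = a ≢ 𝟎 × a ≢ ∞ × (∀ b c → a ≡ b ⊕ c → b ≡ 𝟎 ⊎ c ≡ 𝟎)

  IsAtomList : ∀ {k} → (Fin k → Carrier) → Set
  IsAtomList {k} p =
    (∀ i j → p i ≡ p j → i ≡ j) × (∀ i → IsAtom (p i)) × (∀ a → IsAtom a → ∃ λ i → p i ≡ a)

module Factorizations (N : PCNilsemigroup) {k : ℕ} (p : Fin k → PCNilsemigroup.Carrier N) where
  open PCNilsemigroup N

  _·_ : ℕ → Carrier → Carrier
  n · a = times _⊕_ 𝟎 n a

  evalAux : ∀ {m} → Vec ℕ m → (Fin m → Carrier) → Carrier
  evalAux []       q = 𝟎
  evalAux (n ∷ ns) q = (n · q Fin.zero) ⊕ evalAux ns (λ i → q (Fin.suc i))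

  eval : Vec ℕ k → Carrier
  eval z = evalAux z p

  _∈Z_ : Vec ℕ k → Carrier → Set
  z ∈Z u = eval z ≡ u

  -- z - e_i  (used only when i ∈ supp z)
  _-e_ : Vec ℕ k → Fin k → Vec ℕ k
  z -e i = updateAt z i (λ n → n ∸ 1)

  _∈supp_ : Fin k → Vec ℕ k → Set
  i ∈supp z = 0 < lookup z i

  InZ : Vec ℕ k → Set
  InZ z = (z ∈Z ∞) × (∀ i → i ∈supp z → ¬ ((z -e i) ∈Z ∞))

  Adj : Vec ℕ k → Vec ℕ k → Set
  Adj z z' = Σ (Fin k) λ i → i ∈supp z × i ∈supp z' ×
               Σ Carrier λ q → q ≢ ∞ × ((z -e i) ∈Z q) × ((z' -e i) ∈Z q)

  ZEdge : Vec ℕ k → Vec ℕ k → Set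
  ZEdge z z' = InZ z × InZ z' × Adj z z'

  IsComponent : (Vec ℕ k → Set) → Set
  IsComponent C = (∃ λ z → C z) × (∀ z → C z → InZ z) ×
                  (∀ z z' → C z → InZ z' → (C z' ⇔ Star ZEdge z z'))

  SuppMeet : Vec ℕ k → Vec ℕ k → Set
  SuppMeet z z' = Σ (Fin k) λ i → i ∈supp z × i ∈supp z'

  NablaConnected : (Vec ℕ k → Set) → Set
  NablaConnected B = (∃ λ z → B z) ×
    (∀ z z' → B z → B z' → Star (λ u v → B u × B v × SuppMeet u v) z z')

  _∈_-e_ : Vec ℕ k → (Vec ℕ k → Set) → Fin k → Set
  w ∈ B -e i = Σ (Vec ℕ k) λ z → B z × i ∈supp z × w ≡ z -e i

  IsOuterBetti : (Vec ℕ k → Set) → Set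
  IsOuterBetti B =
    (∀ z → B z → z ∈Z ∞) ×
    (∀ i → (Σ (Vec ℕ k) λ z → B z × i ∈supp z) →
       Σ Carrier λ q → q ≢ ∞ × (∀ w → (w ∈ B -e i) ⇔ (w ∈Z q))) ×
    NablaConnected B

-- Kunz nilsemigroups.
-- A finite abelian group G; vectors x ∈ ℚ^{G∖{0}} are modelled as
-- functions G → ℚ respecting ≈ with x₀ = 0.

module _ (G : AbelianGroup 0ℓ 0ℓ) where
  open AbelianGroup G renaming (Carrier to ∣G∣)

  IsFiniteGroup : Set
  IsFiniteGroup = Σ ℕ λ m → Σ (Fin m → ∣G∣) λ f → ∀ a → ∃ λ i → f i ≈ a

  InGroupCone : (∣G∣ → ℚ) → Set
  InGroupCone x = (∀ a b → a ≈ b → x a ≡ x b) × (x ε ≡ ℚ.0ℚ) ×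
    (∀ i j → i ≉ ε → j ≉ ε → (i ∙ j) ≉ ε → x (i ∙ j) ℚ.≤ x i ℚ.+ x j)

  InFace : (∣G∣ → ∣G∣ → Set) → (∣G∣ → ℚ) → Set
  InFace E x = InGroupCone x ×
    (∀ i j → i ≉ ε → j ≉ ε → (i ∙ j) ≉ ε → E i j → x i ℚ.+ x j ≡ x (i ∙ j))

  InKunzSubgroup : (∣G∣ → ∣G∣ → Set) → ∣G∣ → Set
  InKunzSubgroup E h = ∀ x → InFace E x → x h ≡ ℚ.0ℚ

  _×g_ : ℕ → ∣G∣ → ∣G∣
  zero  ×g a = ε
  suc n ×g a = a ∙ (n ×g a)

  gsum : ∀ {m} → Vec ℕ m → (Fin m → ∣G∣) → ∣G∣
  gsum []       g = ε
  gsum (n ∷ ns) g = (n ×g g Fin.zero) ∙ gsum ns (λ i → g (Fin.suc i))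

-- A Kunz structure on N: an identification of N with the Kunz nilsemigroup
-- (G/H) ∪ {∞} of a finite abelian group G and a face F of 𝒞(G),
-- given by φ : G → N inducing a bijection G/H ≅ N ∖ {∞}.
record KunzStructure (N : PCNilsemigroup) : Set₁ where
  open PCNilsemigroup N
  field
    G       : AbelianGroup 0ℓ 0ℓ
  open AbelianGroup G renaming (Carrier to ∣G∣)
  field
    finiteG : IsFiniteGroup G
    E       : ∣G∣ → ∣G∣ → Set
    φ       : ∣G∣ → Carrier
    φ-notNil : ∀ a → φ a ≢ ∞
    φ-onto   : ∀ u → u ≢ ∞ → ∃ λ a → φ a ≡ u
    φ-kernel : ∀ a b → (φ a ≡ φ b) ⇔ InKunzSubgroup G E (a ∙ b ⁻¹)
    φ-op-def   : ∀ a b → (∀ x → InFace G E x → x a ℚ.+ x b ≡ x (a ∙ b)) →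
                 φ a ⊕ φ b ≡ φ (a ∙ b)
    φ-op-undef : ∀ a b → ¬ (∀ x → InFace G E x → x a ℚ.+ x b ≡ x (a ∙ b)) →
                 φ a ⊕ φ b ≡ ∞

  -- z̄ computed in G/H, via lifts g of the atoms (φ (g i) ≡ p i);
  -- z̄ = z̄' in G/H  iff  φ (gsum z g) ≡ φ (gsum z' g)
  bar : ∀ {k} → (Fin k → ∣G∣) → Vec ℕ k → Carrier
  bar g z = φ (gsum G z g)

-- (a) For an outer Betti element B, the sets B - eᵢ are exactly factorization sets,
-- so an edge of the graph on Z leaving B at atom i lands on a z' with z' - eᵢ ∈ B - eᵢ,
-- hence z' ∈ B because z' is recovered from z' - eᵢ; conversely meeting supports inside
-- B already gives such an edge. (b) In a Kunz nilsemigroup, every finite sum that is not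
-- ∞ is computed in the group G/H, so along an edge z - eᵢ and z' - eᵢ have the same
-- image there, and adding the lift of pᵢ gives z̄ = z̄'.
module Submission where

open import Defs
open import Level using (0ℓ)
open import Data.Nat using (ℕ; zero; suc; pred; _<_; >-nonZero)
open import Data.Nat.Properties using (suc-pred)
open import Data.Fin using (Fin)
import Data.Fin as Fin
open import Data.Vec using (Vec; []; _∷_; lookup; updateAt)
open import Data.Vec.Properties using (updateAt-updateAt; updateAt-id-local)
open import Data.Product using (_×_; _,_; Σ; proj₁; proj₂)
open import Function using (id; _∘_)
open import Relation.Nullary using (¬_)
open import Relation.Nullary.Decidable using (decidable-stable)
open import Relation.Binary.PropositionalEquality
  using (_≡_; _≢_; refl; sym; trans; cong; subst; module ≡-Reasoning)
open import Relation.Binary.Construct.Closure.ReflexiveTransitive using (Star)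
import Relation.Binary.Construct.Closure.ReflexiveTransitive as Star
open import Function.Bundles using (_⇔_; mk⇔; Equivalence)
open import Algebra.Bundles using (AbelianGroup)
open import Algebra.Structures using (IsCommutativeMonoid)
import Algebra.Properties.Group as GroupProperties
import Relation.Binary.Reasoning.Setoid as SetoidReasoning
import Data.Rational as ℚ
import Data.Rational.Properties as ℚ

updateAt-pred-suc : ∀ {m} (v : Vec ℕ m) (i : Fin m) → 0 < lookup v i →
                    updateAt (updateAt v i pred) i suc ≡ v
updateAt-pred-suc v i 0<vᵢ =
  trans (updateAt-updateAt i v) (updateAt-id-local i v (suc-pred _ {{>-nonZero 0<vᵢ}}))

updateAt-pred-injective : ∀ {m} (i : Fin m) {v w : Vec ℕ m} →
                          0 < lookup v i → 0 < lookup w i →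
                          updateAt v i pred ≡ updateAt w i pred → v ≡ w
updateAt-pred-injective i {v} {w} 0<vᵢ 0<wᵢ v-eᵢ≡w-eᵢ = begin
  v                                   ≡⟨ sym (updateAt-pred-suc v i 0<vᵢ) ⟩
  updateAt (updateAt v i pred) i suc  ≡⟨ cong (λ u → updateAt u i suc) v-eᵢ≡w-eᵢ ⟩
  updateAt (updateAt w i pred) i suc  ≡⟨ updateAt-pred-suc w i 0<wᵢ ⟩
  w                                   ∎
  where open ≡-Reasoning

module OuterBetti (N : PCNilsemigroup) {k : ℕ} (p : Fin k → PCNilsemigroup.Carrier N)
                  (B : Vec ℕ k → Set) (isOuterBetti : Factorizations.IsOuterBetti N p B) where
  open PCNilsemigroup N
  open Factorizations N p

  private
    B⊆Z∞ : ∀ {z} → B z → z ∈Z ∞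
    B⊆Z∞ = proj₁ isOuterBetti _

    ∇-connected : NablaConnected B
    ∇-connected = proj₂ (proj₂ isOuterBetti)

  B-e≡Z : ∀ {z} i → B z → i ∈supp z →
          Σ Carrier λ q → q ≢ ∞ × (∀ w → (w ∈ B -e i) ⇔ (w ∈Z q))
  B-e≡Z i z∈B i∈z = proj₁ (proj₂ isOuterBetti) i (_ , z∈B , i∈z)

  B⊆Z : ∀ {z} → B z → InZ z
  B⊆Z {z} z∈B = B⊆Z∞ z∈B , λ i i∈z z-eᵢ∈Z∞ →
    let q , q≢∞ , B-eᵢ≡Zq = B-e≡Z i z∈B i∈z
    in q≢∞ (trans (sym (Equivalence.to (B-eᵢ≡Zq (z -e i)) (z , z∈B , i∈z , refl))) z-eᵢ∈Z∞)

  SuppMeet⇒ZEdge : ∀ {u v} → B u → B v → SuppMeet u v → ZEdge u v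
  SuppMeet⇒ZEdge {u} {v} u∈B v∈B (i , i∈u , i∈v) =
    let q , q≢∞ , B-eᵢ≡Zq = B-e≡Z i u∈B i∈u
    in B⊆Z u∈B , B⊆Z v∈B , i , i∈u , i∈v , q , q≢∞ ,
       Equivalence.to (B-eᵢ≡Zq (u -e i)) (u , u∈B , i∈u , refl) ,
       Equivalence.to (B-eᵢ≡Zq (v -e i)) (v , v∈B , i∈v , refl)

  ZEdge-closed : ∀ {u v} → ZEdge u v → B u → B v
  ZEdge-closed {u} {v} (_ , _ , i , i∈u , i∈v , q , _ , u-eᵢ∈Zq , v-eᵢ∈Zq) u∈B =
    let q′ , _ , B-eᵢ≡Zq′ = B-e≡Z i u∈B i∈u
        q≡q′ = trans (sym u-eᵢ∈Zq) (Equivalence.to (B-eᵢ≡Zq′ (u -e i)) (u , u∈B , i∈u , refl))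
        w , w∈B , i∈w , v-eᵢ≡w-eᵢ =
          Equivalence.from (B-eᵢ≡Zq′ (v -e i)) (subst ((v -e i) ∈Z_) q≡q′ v-eᵢ∈Zq)
    in subst B (sym (updateAt-pred-injective i i∈v i∈w v-eᵢ≡w-eᵢ)) w∈B

  isComponent : IsComponent B
  isComponent = proj₁ ∇-connected , (λ _ → B⊆Z) , λ z z′ z∈B _ →
    mk⇔ (Star.map (λ (u∈B , v∈B , meet) → SuppMeet⇒ZEdge u∈B v∈B meet) ∘ proj₂ ∇-connected z z′ z∈B)
        (λ path → Star.fold (λ u v → B u → B v) (λ edge rest → rest ∘ ZEdge-closed edge) id path z∈B)

  ZEdge⇔SuppMeet : ∀ z z′ → B z → B z′ → ZEdge z z′ ⇔ SuppMeet z z′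
  ZEdge⇔SuppMeet z z′ z∈B z′∈B =
    mk⇔ (λ (_ , _ , i , i∈z , i∈z′ , _) → i , i∈z , i∈z′) (SuppMeet⇒ZEdge z∈B z′∈B)

module PCNilsemigroupProperties (N : PCNilsemigroup) where
  open PCNilsemigroup N
  open IsCommutativeMonoid isCommutativeMonoid using (comm)

  ⊕-≢∞ˡ : ∀ {a b} → a ⊕ b ≢ ∞ → a ≢ ∞
  ⊕-≢∞ˡ {a} {b} a⊕b≢∞ refl = a⊕b≢∞ (trans (comm ∞ b) (nil b))

  ⊕-≢∞ʳ : ∀ {a b} → a ⊕ b ≢ ∞ → b ≢ ∞
  ⊕-≢∞ʳ {a} a⊕b≢∞ refl = a⊕b≢∞ (nil a)

module _ (G : AbelianGroup 0ℓ 0ℓ) where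
  open AbelianGroup G using (Carrier; _≈_; _∙_; assoc; comm; ∙-congˡ)
    renaming (sym to ≈-sym; trans to ≈-trans)

  gsum-updateAt-pred : ∀ {m} (z : Vec ℕ m) (h : Fin m → Carrier) (i : Fin m) → 0 < lookup z i →
                       gsum G z h ≈ gsum G (updateAt z i pred) h ∙ h i
  gsum-updateAt-pred (suc n ∷ z) h Fin.zero _ = ≈-trans (assoc _ _ _) (comm _ _)
  gsum-updateAt-pred (n ∷ z) h (Fin.suc i) 0<zᵢ =
    ≈-trans (∙-congˡ (gsum-updateAt-pred z (h ∘ Fin.suc) i 0<zᵢ)) (≈-sym (assoc _ _ _))

module KunzProperties (N : PCNilsemigroup) (K : KunzStructure N) where
  open PCNilsemigroup N
  open IsCommutativeMonoid isCommutativeMonoid using (identityʳ)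
  open PCNilsemigroupProperties N
  open KunzStructure K
  open AbelianGroup G using (_≈_; _∙_; ε; _⁻¹; setoid; group; assoc; identityˡ; inverseʳ; ∙-congˡ; ∙-congʳ)
    renaming (Carrier to ∣G∣; sym to ≈-sym)
  open GroupProperties group using (x≈y⇒x∙y⁻¹≈ε; ⁻¹-anti-homo-∙)
  open Equivalence using (to; from)

  InH : ∣G∣ → Set
  InH = InKunzSubgroup G E

  ε∈H : InH ε
  ε∈H x x∈F = proj₁ (proj₂ (proj₁ x∈F))

  InH-resp : ∀ {h h′} → h ≈ h′ → InH h → InH h′
  InH-resp h≈h′ h∈H x x∈F = trans (sym (proj₁ (proj₁ x∈F) _ _ h≈h′)) (h∈H x x∈F)

  InH-stable : ∀ h → ¬ ¬ InH h → InH h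
  InH-stable h ¬¬h∈H x x∈F = decidable-stable (x h ℚ.≟ ℚ.0ℚ) (λ xₕ≢0 → ¬¬h∈H (λ h∈H → xₕ≢0 (h∈H x x∈F)))

  φ-cong : ∀ {a b} → a ≈ b → φ a ≡ φ b
  φ-cong {a} {b} a≈b = from (φ-kernel a b) (InH-resp (≈-sym (x≈y⇒x∙y⁻¹≈ε a≈b)) ε∈H)

  φ-∙-congʳ : ∀ {a b} c → φ a ≡ φ b → φ (a ∙ c) ≡ φ (b ∙ c)
  φ-∙-congʳ {a} {b} c φa≡φb =
    from (φ-kernel (a ∙ c) (b ∙ c)) (InH-resp (≈-sym cancel) (to (φ-kernel a b) φa≡φb))
    where
    open SetoidReasoning setoid
    cancel : (a ∙ c) ∙ (b ∙ c) ⁻¹ ≈ a ∙ b ⁻¹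
    cancel = begin
      (a ∙ c) ∙ (b ∙ c) ⁻¹      ≈⟨ ∙-congˡ (⁻¹-anti-homo-∙ b c) ⟩
      (a ∙ c) ∙ (c ⁻¹ ∙ b ⁻¹)   ≈⟨ assoc a c _ ⟩
      a ∙ (c ∙ (c ⁻¹ ∙ b ⁻¹))   ≈⟨ ∙-congˡ (assoc c (c ⁻¹) (b ⁻¹)) ⟨
      a ∙ ((c ∙ c ⁻¹) ∙ b ⁻¹)   ≈⟨ ∙-congˡ (∙-congʳ (inverseʳ c)) ⟩
      a ∙ (ε ∙ b ⁻¹)            ≈⟨ ∙-congˡ (identityˡ (b ⁻¹)) ⟩
      a ∙ b ⁻¹                  ∎

  -- The face condition deciding whether φ a ⊕ φ b is defined is not decidable, so φ-homo
  -- only gets ¬ ¬ (φ a ⊕ φ b ≡ φ (a ∙ b)); membership in H is a family of decidable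
  -- equations in ℚ, which makes equality in the image of φ ¬¬-stable.
  φ-image-stable : ∀ {u} b → u ≢ ∞ → ¬ ¬ (u ≡ φ b) → u ≡ φ b
  φ-image-stable {u} b u≢∞ ¬¬u≡φb with φ-onto u u≢∞
  ... | c , refl = from (φ-kernel c b) (InH-stable _ (λ c∙b⁻¹∉H → ¬¬u≡φb (c∙b⁻¹∉H ∘ to (φ-kernel c b))))

  φ-homo : ∀ a b → φ a ⊕ φ b ≢ ∞ → φ a ⊕ φ b ≡ φ (a ∙ b)
  φ-homo a b φa⊕φb≢∞ =
    φ-image-stable (a ∙ b) φa⊕φb≢∞ (λ ≢φ[a∙b] → φa⊕φb≢∞ (φ-op-undef a b (≢φ[a∙b] ∘ φ-op-def a b)))

  ⊕-lift : ∀ {a b u v} → u ≡ φ a → v ≡ φ b → u ⊕ v ≢ ∞ → u ⊕ v ≡ φ (a ∙ b)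
  ⊕-lift refl refl = φ-homo _ _

  𝟎≢∞ : 𝟎 ≢ ∞
  𝟎≢∞ 𝟎≡∞ = φ-notNil ε (trans (sym (identityʳ (φ ε))) (trans (cong (φ ε ⊕_) 𝟎≡∞) (nil (φ ε))))

  𝟎≡φε : 𝟎 ≡ φ ε
  𝟎≡φε with φ-onto 𝟎 𝟎≢∞
  ... | c , φc≡𝟎 = begin
    𝟎            ≡⟨ φc≡𝟎 ⟨
    φ c          ≡⟨ φ-cong (≈-sym (identityˡ c)) ⟩
    φ (ε ∙ c)    ≡⟨ φ-homo ε c φε⊕φc≢∞ ⟨
    φ ε ⊕ φ c    ≡⟨ φε⊕φc≡φε ⟩
    φ ε          ∎
    where
    open ≡-Reasoning
    φε⊕φc≡φε : φ ε ⊕ φ c ≡ φ ε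
    φε⊕φc≡φε = trans (cong (φ ε ⊕_) φc≡𝟎) (identityʳ (φ ε))
    φε⊕φc≢∞ : φ ε ⊕ φ c ≢ ∞
    φε⊕φc≢∞ = φ-notNil ε ∘ trans (sym φε⊕φc≡φε)

  times-lift : ∀ n {a u} → φ a ≡ u → times _⊕_ 𝟎 n u ≢ ∞ → times _⊕_ 𝟎 n u ≡ φ (_×g_ G n a)
  times-lift zero    _    _    = 𝟎≡φε
  times-lift (suc n) φa≡u nu≢∞ = ⊕-lift (sym φa≡u) (times-lift n φa≡u (⊕-≢∞ʳ nu≢∞)) nu≢∞

  module _ {k : ℕ} (p : Fin k → Carrier) where
    open Factorizations N p

    evalAux-lift : ∀ {m} (z : Vec ℕ m) {q : Fin m → Carrier} (h : Fin m → ∣G∣) →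
                   (∀ i → φ (h i) ≡ q i) → evalAux z q ≢ ∞ → evalAux z q ≡ φ (gsum G z h)
    evalAux-lift []      h _       _   = 𝟎≡φε
    evalAux-lift (n ∷ z) h h-lifts z≢∞ =
      ⊕-lift (times-lift n (h-lifts Fin.zero) (⊕-≢∞ˡ z≢∞))
             (evalAux-lift z (h ∘ Fin.suc) (h-lifts ∘ Fin.suc) (⊕-≢∞ʳ z≢∞))
             z≢∞

    module _ (g : Fin k → ∣G∣) (g-lifts-p : ∀ i → φ (g i) ≡ p i) where

      eval≡bar : ∀ z → eval z ≢ ∞ → eval z ≡ bar g z
      eval≡bar z = evalAux-lift z g g-lifts-p

      ZEdge⇒bar≡ : ∀ {u v} → ZEdge u v → bar g u ≡ bar g v
      ZEdge⇒bar≡ {u} {v} (_ , _ , i , i∈u , i∈v , q , q≢∞ , u-eᵢ∈Zq , v-eᵢ∈Zq) = begin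
        bar g u                           ≡⟨ φ-cong (gsum-updateAt-pred G u g i i∈u) ⟩
        φ (gsum G (u -e i) g ∙ g i)       ≡⟨ φ-∙-congʳ (g i) bar[u-eᵢ]≡bar[v-eᵢ] ⟩
        φ (gsum G (v -e i) g ∙ g i)       ≡⟨ φ-cong (gsum-updateAt-pred G v g i i∈v) ⟨
        bar g v                           ∎
        where
        open ≡-Reasoning
        bar[u-eᵢ]≡bar[v-eᵢ] : bar g (u -e i) ≡ bar g (v -e i)
        bar[u-eᵢ]≡bar[v-eᵢ] = begin
          bar g (u -e i)  ≡⟨ eval≡bar (u -e i) (q≢∞ ∘ trans (sym u-eᵢ∈Zq)) ⟨
          eval (u -e i)   ≡⟨ u-eᵢ∈Zq ⟩
          q               ≡⟨ v-eᵢ∈Zq ⟨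
          eval (v -e i)   ≡⟨ eval≡bar (v -e i) (q≢∞ ∘ trans (sym v-eᵢ∈Zq)) ⟩
          bar g (v -e i)  ∎

      component-bar≡ : ∀ (C : Vec ℕ k → Set) → IsComponent C → ∀ z z′ → C z → C z′ → bar g z ≡ bar g z′
      component-bar≡ C (_ , C⊆Z , C-connected) z z′ z∈C z′∈C =
        Star.fold (λ u v → bar g u ≡ bar g v) (λ {u} {v} edge → trans (ZEdge⇒bar≡ {u} {v} edge)) refl
                  (to (C-connected z z′ z∈C (C⊆Z z′ z′∈C)) z′∈C)

-- Neither part needs p to list the atoms: the argument works for any family p.
lemma5p6 : (N : PCNilsemigroup) (k : ℕ) (p : Fin k → PCNilsemigroup.Carrier N) →
    PCNilsemigroup.IsAtomList N p →
    (∀ (B : Vec ℕ k → Set) → Factorizations.IsOuterBetti N p B →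
      Factorizations.IsComponent N p B ×
      (∀ z z' → B z → B z' → (Factorizations.ZEdge N p z z' ⇔ Factorizations.SuppMeet N p z z')))
    ×
    ((K : KunzStructure N) (g : Fin k → AbelianGroup.Carrier (KunzStructure.G K)) →
      (∀ i → KunzStructure.φ K (g i) ≡ p i) →
      ∀ (B : Vec ℕ k → Set) → Factorizations.IsComponent N p B →
      ∀ z z' → B z → B z' → KunzStructure.bar K g z ≡ KunzStructure.bar K g z')
lemma5p6 N k p _ =
  (λ B isOuterBetti → let open OuterBetti N p B isOuterBetti in isComponent , ZEdge⇔SuppMeet) ,
  (λ K g g-lifts-p → KunzProperties.component-bar≡ N K p g g-lifts-p)
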